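{- There exists a connected highly arc transitive digraph $D$ with Property $Z$, witnessed by an epimorphism $\varphi: D\to Z$ all of whose fibers $\varphi^{ -1}(i)$, $i\in\mathbb{Z}$, are finite, such that the associated digraph $\Delta(D)$ is not complete bipartite.
   Context: Digraphs have directed edges $e=(x_e,y_e)$. An $n$-arc is a sequence $(e_i)_{i=0,\dots,n-1}$ of directed edges with $y_{e_i}=x_{e_{i+1}}$ for all $i$. A digraph is highly arc transitive (HAT) if for every $n\in\mathbb{N}$ its automorphism group acts transitively on the (nonempty) set of its $n$-arcs. An alternating walk is a sequence $(e_i)_{i=0,\dots,n-1}$ of directed edges in which consecutive edges alternately share their initial vertex and their terminal vertex (i.e. $x_{e_i}=x_{e_{i+1}}$ for every even $i$ and $y_{e_i}=y_{e_{i+1}}$ for every odd $i$, or vice versa). Two edges are reachable from each other if some alternating walk contains both; this is an equivalence relation on edges. For an edge $e$, $\Delta(e)$ is the subdigraph spanned by the reachability class of $e$; in a HAT digraph all $\Delta(e)$ are isomorphic and this common digraph is called the associated digraph $\Delta(D)$. Let $Z$ be the digraph with vertex set $\mathbb{Z}$ and edges $(i,i+1)$, $i\in\mathbb{Z}$. A digraph has Property $Z$ if there is an epimorphism (surjective digraph homomorphism) $\varphi$ from it onto $Z$. -}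

module Defs where

open import Data.Nat using (ℕ; zero; suc; _<_)
open import Data.Nat.Properties using (<-trans; n<1+n)
open import Data.Fin using (Fin; fromℕ<)
open import Data.Integer using (ℤ; _+_; +_)
open import Data.Bool using (Bool; true; false; not)
open import Data.Product using (Σ; ∃; ∃-syntax; _×_; _,_; proj₁; proj₂)
open import Data.Empty using (⊥)
open import Relation.Nullary using (¬_)
open import Relation.Binary.PropositionalEquality using (_≡_)
open import Function.Bundles using (_↔_; _⇔_; Inverse)

-- A digraph: a vertex set and an edge relation (a set of ordered pairs;
-- the relation is required to be proof-irrelevant, so no multi-edges).
record Digraph : Set₁ where
  field
    V    : Set
    E    : V → V → Set
    E-prop : ∀ {x y} (p q : E x y) → p ≡ q
open Digraph public

module _ (D : Digraph) where

  Edge : Set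
  Edge = Σ (V D × V D) λ xy → E D (proj₁ xy) (proj₂ xy)

  src tgt : Edge → V D
  src e = proj₁ (proj₁ e)
  tgt e = proj₂ (proj₁ e)

  record Arc (n : ℕ) : Set where
    field
      edge  : Fin n → Edge
      chain : ∀ (i : ℕ) (p : suc i < n) →
              tgt (edge (fromℕ< (<-trans (n<1+n i) p))) ≡ src (edge (fromℕ< p))
  open Arc public

  record Automorphism : Set where
    field
      perm  : V D ↔ V D
      hom   : ∀ x y → E D x y ⇔ E D (Inverse.to perm x) (Inverse.to perm y)
  open Automorphism public

  MapsArc : ∀ {n} → Automorphism → Arc n → Arc n → Set
  MapsArc g a b = ∀ i → (Inverse.to (perm g) (src (edge a i)) ≡ src (edge b i))
                      × (Inverse.to (perm g) (tgt (edge a i)) ≡ tgt (edge b i))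

  HAT : Set
  HAT = ∀ (n : ℕ) → Arc n × (∀ (a b : Arc n) → ∃[ g ] MapsArc g a b)

  data UWalk : V D → V D → Set where
    here : ∀ {x} → UWalk x x
    fwd  : ∀ {x y z} → E D x y → UWalk y z → UWalk x z
    bwd  : ∀ {x y z} → E D y x → UWalk y z → UWalk x z

  Connected : Set
  Connected = ∀ x y → UWalk x y

  Shares : Bool → Edge → Edge → Set
  Shares true  e f = src e ≡ src f
  Shares false e f = tgt e ≡ tgt f

  alt : Bool → ℕ → Bool
  alt b zero    = b
  alt b (suc i) = not (alt b i)

  record AltWalk : Set where
    field
      len   : ℕ
      start : Bool
      wedge : Fin len → Edge
      alter : ∀ (i : ℕ) (p : suc i < len) →
              Shares (alt start i) (wedge (fromℕ< (<-trans (n<1+n i) p))) (wedge (fromℕ< p))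
  open AltWalk public

  SameEdge : Edge → Edge → Set
  SameEdge e f = proj₁ e ≡ proj₁ f

  Reachable : Edge → Edge → Set
  Reachable e f = ∃[ w ] (∃[ i ] SameEdge (wedge w i) e) × (∃[ j ] SameEdge (wedge w j) f)

  ΔVertex : Edge → V D → Set
  ΔVertex e v = ∃[ f ] Reachable e f × ((src f ≡ v) Data.Sum.⊎ (tgt f ≡ v))
    where import Data.Sum

  ΔEdge : Edge → V D → V D → Set
  ΔEdge e u v = Σ (E D u v) λ p → Reachable e ((u , v) , p)

  CompleteBipartiteΔ : Edge → Set₁
  CompleteBipartiteΔ e =
    Σ (V D → Set) λ A → Σ (V D → Set) λ B →
      (∀ v → ΔVertex e v → A v Data.Sum.⊎ B v) ×
      (∀ v → A v → ΔVertex e v) × (∀ v → B v → ΔVertex e v) ×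
      (∀ v → A v → B v → ⊥) ×
      (∃[ a ] A a) × (∃[ b ] B b) ×
      (∀ u v → ΔVertex e u → ΔVertex e v → (ΔEdge e u v ⇔ (A u × B v)))
    where import Data.Sum

Zdigraph : Digraph
Zdigraph = record { V = ℤ ; E = λ i j → j ≡ i + + 1 ; E-prop = uip }
  where
  uip : ∀ {a b : ℤ} (p q : a ≡ b) → p ≡ q
  uip Relation.Binary.PropositionalEquality.refl Relation.Binary.PropositionalEquality.refl = Relation.Binary.PropositionalEquality.refl

record EpiToZ (D : Digraph) : Set where
  field
    φ    : V D → ℤ
    φ-hom : ∀ {x y} → E D x y → φ y ≡ φ x + + 1
    φ-surj : ∀ (i : ℤ) → ∃[ v ] φ v ≡ i
open EpiToZ public

FiniteFibers : ∀ {D} → EpiToZ D → Set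
FiniteFibers {D} ψ = ∀ (i : ℤ) → ∃[ n ] Σ (Fin n → V D) λ f →
  ∀ v → φ ψ v ≡ i → ∃[ k ] f k ≡ v

-- Let B be the 6-cycle, seen as a bipartite graph with parts Out = In = ℤ₃
-- in which s is joined to every t except s − 1.  The digraph D has vertices
-- (l , t , s) ∈ ℤ × In × Out and an edge (l , t , s) → (l + 1 , t' , s')
-- whenever s ∼ t' in B, so the projection to ℤ is an epimorphism onto Z
-- with fibres of size 9.  The edges between two consecutive layers form B
-- with every vertex replaced by three independent copies; this is Δ(D).
-- It is not complete bipartite because C₆ is not: a path s ∼ t' ∼ s' ∼ t
-- in B with s ≁ t lifts to an alternating walk of four edges in D.
--
-- The symmetries of B can be applied independently between each pair of
-- consecutive layers.  Combined with the shifts of ℤ this makes D vertex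
-- transitive, and a relabelling that acts only above the layer of a vertex
-- v fixes everything below v, fixes v, and moves any out-neighbour of v to
-- any other.  An automorphism matching two n-arcs is then built one edge
-- at a time.

module Submission where

open import Defs
open import Data.Bool using (Bool; true; false; T)
open import Data.Bool.Properties using (T-irrelevant)
open import Data.Empty using (⊥-elim)
open import Data.Fin using (Fin; zero; suc; toℕ; fromℕ<; combine; remQuot)
open import Data.Fin.Properties using (toℕ<n; toℕ-fromℕ<; fromℕ<-toℕ; remQuot-combine)
open import Data.Integer as ℤ using (ℤ; +_; -[1+_]; _+_; _-_; _<_)
import Data.Integer.Properties as ℤ
open import Data.Integer.Tactic.RingSolver using (solve-∀)
open import Data.Nat as ℕ using (ℕ; zero; suc; s≤s)
import Data.Nat.Properties as ℕ
open import Data.Product using (Σ; Σ-syntax; ∃-syntax; _×_; _,_; proj₁; proj₂; map)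
open import Data.Sum using (inj₁; inj₂)
open import Data.Unit using (tt)
open import Function.Base using (_∘_)
open import Function.Bundles using (_↔_; _⇔_; Inverse; Equivalence; mk↔ₛ′; mk⇔)
open import Function.Construct.Composition using (_↔-∘_; _⇔-∘_)
open import Function.Construct.Identity using (↔-id; ⇔-id)
open import Function.Construct.Symmetry using (↔-sym)
open import Relation.Binary.Construct.Closure.ReflexiveTransitive using (Star; ε; _◅_)
open import Relation.Binary.PropositionalEquality
open import Relation.Nullary using (¬_; yes; no)
import Axiom.UniquenessOfIdentityProofs as UIP

module _ {D : Digraph} where

  infixr 5 _++ᵘ_

  _++ᵘ_ : ∀ {x y z} → UWalk D x y → UWalk D y z → UWalk D x z
  here      ++ᵘ w = w
  fwd e w′  ++ᵘ w = fwd e (w′ ++ᵘ w)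
  bwd e w′  ++ᵘ w = bwd e (w′ ++ᵘ w)

  reverseᵘ : ∀ {x y} → UWalk D x y → UWalk D y x
  reverseᵘ here      = here
  reverseᵘ (fwd e w) = reverseᵘ w ++ᵘ bwd e here
  reverseᵘ (bwd e w) = reverseᵘ w ++ᵘ fwd e here

  act : Automorphism D → V D → V D
  act g = Inverse.to (Automorphism.perm g)

  mkAutomorphism : (f f⁻¹ : V D → V D) →
                   (∀ y → f (f⁻¹ y) ≡ y) → (∀ x → f⁻¹ (f x) ≡ x) →
                   (∀ x y → E D x y ⇔ E D (f x) (f y)) → Automorphism D
  mkAutomorphism f f⁻¹ f∘f⁻¹ f⁻¹∘f hom =
    record { perm = mk↔ₛ′ f f⁻¹ f∘f⁻¹ f⁻¹∘f ; hom = hom }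

  idᵃ : Automorphism D
  idᵃ = record { perm = ↔-id (V D) ; hom = λ _ _ → ⇔-id _ }

  infixr 9 _∘ᵃ_

  _∘ᵃ_ : Automorphism D → Automorphism D → Automorphism D
  g ∘ᵃ h = record
    { perm = Automorphism.perm g ↔-∘ Automorphism.perm h
    ; hom  = λ x y → Automorphism.hom g (act h x) (act h y) ⇔-∘ Automorphism.hom h x y }

i<i+1 : ∀ i → i < i + + 1
i<i+1 i = ℤ.suc[i]≤j⇒i<j (ℤ.≤-reflexive (ℤ.+-comm (+ 1) i))

module ArcTransitivity (D : Digraph) (level : V D → ℤ)
         (level-hom : ∀ {x y} → E D x y → level y ≡ level x + + 1) where

  VertexTransitive : Set
  VertexTransitive = ∀ u w → Σ[ g ∈ Automorphism D ] act g u ≡ w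

  OutNeighbourTransitiveFixingBelow : Set
  OutNeighbourTransitiveFixingBelow = ∀ {v x y} → E D v x → E D v y →
    Σ[ h ∈ Automorphism D ] act h v ≡ v × act h x ≡ y × (∀ z → level z < level v → act h z ≡ z)

  module _ (vertexTransitive : VertexTransitive)
           (extend : OutNeighbourTransitiveFixingBelow)
           {n : ℕ} (a b : Arc D n) where

    edgeᵃ edgeᵇ : ∀ k → .(k ℕ.< n) → Edge D
    edgeᵃ k p = Arc.edge a (fromℕ< p)
    edgeᵇ k p = Arc.edge b (fromℕ< p)

    sᵃ tᵃ sᵇ tᵇ : ∀ k → .(k ℕ.< n) → V D
    sᵃ k p = src D (edgeᵃ k p)
    tᵃ k p = tgt D (edgeᵃ k p)
    sᵇ k p = src D (edgeᵇ k p)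
    tᵇ k p = tgt D (edgeᵇ k p)

    sᵇ-level-<suc : ∀ k (p : suc k ℕ.< n) → level (sᵇ k (ℕ.<⇒≤ p)) < level (sᵇ (suc k) p)
    sᵇ-level-<suc k p = ℤ.<-≤-trans (i<i+1 _) (ℤ.≤-reflexive (begin
      level (sᵇ k _) + + 1  ≡⟨ level-hom (proj₂ (edgeᵇ k _)) ⟨
      level (tᵇ k _)        ≡⟨ cong level (Arc.chain b k p) ⟩
      level (sᵇ (suc k) p)  ∎))
      where open ≡-Reasoning

    sᵇ-level-increasing : ∀ {i j} (pi : i ℕ.< n) (pj : j ℕ.< n) → i ℕ.< j →
                          level (sᵇ i pi) < level (sᵇ j pj)
    sᵇ-level-increasing {i} {suc j} pi pj (s≤s i≤j) with ℕ.m≤n⇒m<n∨m≡n i≤j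
    ... | inj₁ i<j  = ℤ.<-trans (sᵇ-level-increasing pi (ℕ.<⇒≤ pj) i<j) (sᵇ-level-<suc j pj)
    ... | inj₂ refl = sᵇ-level-<suc j pj

    MapsEdge : Automorphism D → ∀ k → .(k ℕ.< n) → Set
    MapsEdge g k p = act g (sᵃ k p) ≡ sᵇ k p × act g (tᵃ k p) ≡ tᵇ k p

    MapsPrefix : Automorphism D → ℕ → Set
    MapsPrefix g m = ∀ k (p : k ℕ.< n) → k ℕ.< m → MapsEdge g k p

    mapsNextSource : ∀ m (p : m ℕ.< n) → ∃[ g ] MapsPrefix g m →
                     ∃[ g ] MapsPrefix g m × act g (sᵃ m p) ≡ sᵇ m p
    mapsNextSource zero    p _ =
      let g , g-s = vertexTransitive (sᵃ 0 p) (sᵇ 0 p) in g , (λ _ _ ()) , g-s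
    mapsNextSource (suc m) p (g , maps) = g , maps , (begin
      act g (sᵃ (suc m) p)  ≡⟨ cong (act g) (Arc.chain a m p) ⟨
      act g (tᵃ m _)        ≡⟨ proj₂ (maps m (ℕ.<⇒≤ p) (ℕ.n<1+n m)) ⟩
      tᵇ m _                ≡⟨ Arc.chain b m p ⟩
      sᵇ (suc m) p          ∎)
      where open ≡-Reasoning

    image-edge : ∀ m (p : m ℕ.< n) (g : Automorphism D) →
                 act g (sᵃ m p) ≡ sᵇ m p → E D (sᵇ m p) (act g (tᵃ m p))
    image-edge m p g g-sᵃ = subst (λ u → E D u (act g (tᵃ m p))) g-sᵃ
      (Equivalence.to (Automorphism.hom g _ _) (proj₂ (edgeᵃ m p)))

    extendPrefix : ∀ m (p : m ℕ.< n) → ∃[ g ] MapsPrefix g m × act g (sᵃ m p) ≡ sᵇ m p →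
                   ∃[ g ] MapsPrefix g (suc m)
    extendPrefix m p (g , maps , g-sᵃ) with extend (image-edge m p g g-sᵃ) (proj₂ (edgeᵇ m p))
    ... | h , h-v , h-x , h-below = h ∘ᵃ g , maps′
      where
      -- The vertices of b before sᵇ m lie on lower levels.
      fixes : ∀ k (q : k ℕ.< n) → k ℕ.≤ m → act h (sᵇ k q) ≡ sᵇ k q
      fixes k q k≤m with ℕ.m≤n⇒m<n∨m≡n k≤m
      ... | inj₁ k<m  = h-below _ (sᵇ-level-increasing q p k<m)
      ... | inj₂ refl = h-v

      maps′ : MapsPrefix (h ∘ᵃ g) (suc m)
      maps′ k q (s≤s k≤m) with ℕ.m≤n⇒m<n∨m≡n k≤m
      ... | inj₂ refl = trans (cong (act h) g-sᵃ) h-v , h-x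
      ... | inj₁ k<m  = trans (cong (act h) (proj₁ (maps k q k<m))) (fixes k q k≤m) , (begin
        act h (act g (tᵃ k q))  ≡⟨ cong (act h) (proj₂ (maps k q k<m)) ⟩
        act h (tᵇ k q)          ≡⟨ cong (act h) (Arc.chain b k q′) ⟩
        act h (sᵇ (suc k) q′)   ≡⟨ fixes (suc k) q′ k<m ⟩
        sᵇ (suc k) q′           ≡⟨ Arc.chain b k q′ ⟨
        tᵇ k q                  ∎)
        where
        open ≡-Reasoning
        q′ = ℕ.<-≤-trans (s≤s k<m) p

    mapsPrefix : ∀ m → m ℕ.≤ n → ∃[ g ] MapsPrefix g m
    mapsPrefix zero    _ = idᵃ , λ _ _ ()
    mapsPrefix (suc m) p = extendPrefix m p (mapsNextSource m p (mapsPrefix m (ℕ.<⇒≤ p)))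

    arcTransitive : ∃[ g ] MapsArc D g a b
    arcTransitive = g , λ i →
      subst (λ j → (act g (src D (Arc.edge a j)) ≡ src D (Arc.edge b j)) ×
                   (act g (tgt D (Arc.edge a j)) ≡ tgt D (Arc.edge b j)))
            (fromℕ<-toℕ i (toℕ<n i))
            (maps (toℕ i) (toℕ<n i) (toℕ<n i))
      where
      g = proj₁ (mapsPrefix n ℕ.≤-refl)
      maps = proj₂ (mapsPrefix n ℕ.≤-refl)

FinitelyEnumerable : Set → Set
FinitelyEnumerable A = ∃[ n ] Σ (Fin n → A) λ f → ∀ x → ∃[ k ] f k ≡ x

×-finitelyEnumerable : ∀ {A B} → FinitelyEnumerable A → FinitelyEnumerable B →
                       FinitelyEnumerable (A × B)
×-finitelyEnumerable (m , f , f-onto) (n , g , g-onto) =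
  m ℕ.* n , (λ k → map f g (remQuot {m} n k)) , λ (x , y) →
    let i , fi≡x = f-onto x
        j , gj≡y = g-onto y
    in combine i j , trans (cong (map f g) (remQuot-combine {m} {n} i j)) (cong₂ _,_ fi≡x gj≡y)

record LabelGraph : Set₁ where
  field
    Out In : Set
    adj    : Out → In → Bool

  Adj : Out → In → Set
  Adj s t = T (adj s t)

  record Symmetry : Set where
    field
      onOut         : Out ↔ Out
      onIn          : In ↔ In
      adj-invariant : ∀ s t → adj (Inverse.to onOut s) (Inverse.to onIn t) ≡ adj s t

  out : Symmetry → Out → Out
  out g = Inverse.to (Symmetry.onOut g)

  inn : Symmetry → In → In
  inn g = Inverse.to (Symmetry.onIn g)

  idˢ : Symmetry
  idˢ = record { onOut = ↔-id Out ; onIn = ↔-id In ; adj-invariant = λ _ _ → refl }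

  infixr 9 _∘ˢ_
  infix 10 _⁻¹ˢ

  _∘ˢ_ : Symmetry → Symmetry → Symmetry
  g ∘ˢ h = record
    { onOut         = Symmetry.onOut g ↔-∘ Symmetry.onOut h
    ; onIn          = Symmetry.onIn g ↔-∘ Symmetry.onIn h
    ; adj-invariant = λ s t → trans (Symmetry.adj-invariant g (out h s) (inn h t))
                                    (Symmetry.adj-invariant h s t) }

  _⁻¹ˢ : Symmetry → Symmetry
  g ⁻¹ˢ = record
    { onOut         = ↔-sym (Symmetry.onOut g)
    ; onIn          = ↔-sym (Symmetry.onIn g)
    ; adj-invariant = λ s t → trans (sym (Symmetry.adj-invariant g _ _))
        (cong₂ adj (Inverse.inverseˡ (Symmetry.onOut g) refl)
                   (Inverse.inverseˡ (Symmetry.onIn g) refl)) }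

  OutTransitive InTransitive LocallyTransitive : Set
  OutTransitive     = ∀ s s′ → ∃[ g ] out g s ≡ s′
  InTransitive      = ∀ t t′ → ∃[ g ] inn g t ≡ t′
  LocallyTransitive = ∀ {s t t′} → Adj s t → Adj s t′ → ∃[ g ] out g s ≡ s × inn g t ≡ t′

  outTransitive-fromOrbit : ∀ s₀ → (∀ s → ∃[ g ] out g s₀ ≡ s) → OutTransitive
  outTransitive-fromOrbit s₀ orbit s s′ =
    let g , gs₀≡s = orbit s ; g′ , g′s₀≡s′ = orbit s′ in
    g′ ∘ˢ g ⁻¹ˢ ,
    trans (cong (out g′) (Inverse.inverseʳ (Symmetry.onOut g) (sym gs₀≡s))) g′s₀≡s′

  inTransitive-fromOrbit : ∀ t₀ → (∀ t → ∃[ g ] inn g t₀ ≡ t) → InTransitive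
  inTransitive-fromOrbit t₀ orbit t t′ =
    let g , gt₀≡t = orbit t ; g′ , g′t₀≡t′ = orbit t′ in
    g′ ∘ˢ g ⁻¹ˢ ,
    trans (cong (inn g′) (Inverse.inverseʳ (Symmetry.onIn g) (sym gt₀≡t))) g′t₀≡t′

  -- Conjugate the stabiliser of s₀ by a symmetry carrying s₀ to s.
  locallyTransitive-fromStabiliser :
    ∀ s₀ → (∀ s → ∃[ g ] out g s₀ ≡ s) →
    (∀ {t t′} → Adj s₀ t → Adj s₀ t′ → ∃[ g ] out g s₀ ≡ s₀ × inn g t ≡ t′) →
    LocallyTransitive
  locallyTransitive-fromStabiliser s₀ orbit stabiliser {s} {t} {t′} st st′ =
    h ∘ˢ (k ∘ˢ h ⁻¹ˢ) , (begin
      out h (out k (h⁻¹ s))  ≡⟨ cong (out h ∘ out k) h⁻¹s≡s₀ ⟩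
      out h (out k s₀)       ≡⟨ cong (out h) k-s₀ ⟩
      out h s₀               ≡⟨ hs₀≡s ⟩
      s                      ∎) ,
    trans (cong (inn h) k-t) (Inverse.inverseˡ (Symmetry.onIn h) refl)
    where
    open ≡-Reasoning
    h = proj₁ (orbit s)
    hs₀≡s = proj₂ (orbit s)
    h⁻¹ = Inverse.from (Symmetry.onOut h)
    h⁻¹s≡s₀ : h⁻¹ s ≡ s₀
    h⁻¹s≡s₀ = Inverse.inverseʳ (Symmetry.onOut h) (sym hs₀≡s)
    adj-h⁻¹ : ∀ {u} → Adj s u → Adj s₀ (inn (h ⁻¹ˢ) u)
    adj-h⁻¹ {u} su = subst T (trans (sym (Symmetry.adj-invariant (h ⁻¹ˢ) s u))
                                     (cong (λ s″ → adj s″ (inn (h ⁻¹ˢ) u)) h⁻¹s≡s₀)) su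
    k = proj₁ (stabiliser (adj-h⁻¹ st) (adj-h⁻¹ st′))
    k-s₀ = proj₁ (proj₂ (stabiliser (adj-h⁻¹ st) (adj-h⁻¹ st′)))
    k-t = proj₂ (proj₂ (stabiliser (adj-h⁻¹ st) (adj-h⁻¹ st′)))

  SharesNeighbour : Out → Out → Set
  SharesNeighbour s s′ = ∃[ t ] Adj s t × Adj s′ t

  HasNonNeighbourAtDistance3 : Out → Set
  HasNonNeighbourAtDistance3 s =
    ∃[ s′ ] ∃[ t′ ] ∃[ t ] Adj s t′ × Adj s′ t′ × Adj s′ t × ¬ Adj s t

module _ {D : Digraph} where

  reachable-zigzag : (e e₁ e₂ f : Edge D) →
                     Shares D true e e₁ → Shares D false e₁ e₂ → Shares D true e₂ f →
                     Reachable D e e × Reachable D e f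
  reachable-zigzag e e₁ e₂ f e-e₁ e₁-e₂ e₂-f =
    (walk , (zero , refl) , (zero , refl)) ,
    (walk , (zero , refl) , (suc (suc (suc zero)) , refl))
    where
    edges : Fin 4 → Edge D
    edges zero                   = e
    edges (suc zero)             = e₁
    edges (suc (suc zero))       = e₂
    edges (suc (suc (suc zero))) = f

    alternates : ∀ i (p : suc i ℕ.< 4) →
                 Shares D (alt D true i) (edges (fromℕ< (ℕ.<-trans (ℕ.n<1+n i) p))) (edges (fromℕ< p))
    alternates 0 _ = e-e₁
    alternates 1 _ = e₁-e₂
    alternates 2 _ = e₂-f
    alternates (suc (suc (suc _))) (s≤s (s≤s (s≤s (s≤s ()))))

    walk : AltWalk D
    walk = record { len = 4 ; start = true ; wedge = edges ; alter = alternates }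

  completeBipartiteΔ-joins : ∀ {e f} → CompleteBipartiteΔ D e →
                             Reachable D e e → Reachable D e f → E D (src D e) (tgt D f)
  completeBipartiteΔ-joins {e} {f} (_ , _ , _ , _ , _ , _ , _ , _ , edges⇔) e~e e~f =
    proj₁ (Equivalence.from (edges⇔ (src D e) (tgt D f) e-src f-tgt) (proj₁ e∈A×B , proj₂ f∈A×B))
    where
    e-src = e , e~e , inj₁ refl
    f-tgt = f , e~f , inj₂ refl
    e∈A×B = Equivalence.to (edges⇔ (src D e) (tgt D e) e-src (e , e~e , inj₂ refl)) (proj₂ e , e~e)
    f∈A×B = Equivalence.to (edges⇔ (src D f) (tgt D f) (f , e~f , inj₁ refl) f-tgt) (proj₂ f , e~f)

module Layered (B : LabelGraph) where
  open LabelGraph B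

  Vertex : Set
  Vertex = ℤ × In × Out

  level : Vertex → ℤ
  level = proj₁

  inLabel : Vertex → In
  inLabel = proj₁ ∘ proj₂

  outLabel : Vertex → Out
  outLabel = proj₂ ∘ proj₂

  Step : Vertex → Vertex → Set
  Step u v = level v ≡ level u + + 1 × Adj (outLabel u) (inLabel v)

  step-irrelevant : ∀ {u v} (p q : Step u v) → p ≡ q
  step-irrelevant (e , a) (e′ , a′) =
    cong₂ _,_ (UIP.Decidable⇒UIP.≡-irrelevant ℤ._≟_ e e′) (T-irrelevant a a′)

  layered : Digraph
  layered = record { V = Vertex ; E = Step ; E-prop = λ {u} {v} → step-irrelevant {u} {v} }

  levelEpi : In → Out → EpiToZ layered
  levelEpi t s = record { φ = level ; φ-hom = proj₁ ; φ-surj = λ i → (i , t , s) , refl }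

  levelEpi-finiteFibers : ∀ t s → FinitelyEnumerable (In × Out) → FiniteFibers (levelEpi t s)
  levelEpi-finiteFibers t s (n , f , f-onto) i = n , (λ k → i , f k) , onto
    where
    onto : ∀ v → level v ≡ i → ∃[ k ] (i , f k) ≡ v
    onto (l , ts) l≡i = proj₁ (f-onto ts) , cong₂ _,_ (sym l≡i) (proj₂ (f-onto ts))

  module _ {s₀ : Out} {t₀ : In} (s₀t₀ : Adj s₀ t₀) where

    walkWithinLevel : ∀ {s s′} → SharesNeighbour s s′ → ∀ l t t′ →
                      UWalk layered (l , t , s) (l , t′ , s′)
    walkWithinLevel {s} (m , sm , s′m) l t t′ =
      fwd {y = l + + 1 , m , s} (refl , sm) (bwd (refl , s′m) here)

    walkToBase : ∀ {s} → Star SharesNeighbour s s₀ → ∀ l t → UWalk layered (l , t , s) (l , t₀ , s₀)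
    walkToBase ε        l t = walkWithinLevel (t₀ , s₀t₀ , s₀t₀) l t t₀
    walkToBase (x ◅ xs) l t = walkWithinLevel x l t t₀ ++ᵘ walkToBase xs l t₀

    walkToLevel0 : ∀ l → UWalk layered (l , t₀ , s₀) (+ 0 , t₀ , s₀)
    walkToLevel0 (+ zero)     = here
    walkToLevel0 (+ suc n)    = bwd {y = + n , t₀ , s₀} (cong +_ (ℕ.+-comm 1 n) , s₀t₀) (walkToLevel0 (+ n))
    walkToLevel0 -[1+ zero ]  = fwd (refl , s₀t₀) here
    walkToLevel0 -[1+ suc n ] = fwd {y = -[1+ n ] , t₀ , s₀} (refl , s₀t₀) (walkToLevel0 -[1+ n ])

    layered-connected : (∀ s → Star SharesNeighbour s s₀) → Connected layered
    layered-connected reach (l , t , s) (l′ , t′ , s′) =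
      walkToBase (reach s) l t ++ᵘ walkToLevel0 l ++ᵘ
      reverseᵘ (walkToBase (reach s′) l′ t′ ++ᵘ walkToLevel0 l′)

    verticalArc : ∀ n → Arc layered n
    verticalArc n = record
      { edge  = λ k → (vertical (toℕ k) , vertical (suc (toℕ k))) , (cong +_ (ℕ.+-comm 1 (toℕ k)) , s₀t₀)
      ; chain = λ i p → cong vertical (trans (cong suc (toℕ-fromℕ< _)) (sym (toℕ-fromℕ< p))) }
      where
      vertical : ℕ → Vertex
      vertical k = + k , t₀ , s₀

  shift : ℤ → Automorphism layered
  shift c = mkAutomorphism (λ v → level v + c , proj₂ v) (λ v → level v - c , proj₂ v)
    (λ v → cong (_, proj₂ v) (sub-add (level v) c))
    (λ v → cong (_, proj₂ v) (add-sub (level v) c))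
    (λ u v → mk⇔ (λ (e , a) → shift-succ (level u) (level v) e , a)
                 (λ (e , a) → unshift-succ (level u) (level v) e , a))
    where
    sub-add : ∀ l c → l - c + c ≡ l
    sub-add = solve-∀
    add-sub : ∀ l c → l + c - c ≡ l
    add-sub = solve-∀
    succ-add : ∀ l c → l + + 1 + c ≡ l + c + + 1
    succ-add = solve-∀
    add-succ-sub : ∀ l c → l + c + + 1 - c ≡ l + + 1
    add-succ-sub = solve-∀

    shift-succ : ∀ l l′ → l′ ≡ l + + 1 → l′ + c ≡ l + c + + 1
    shift-succ l _ refl = succ-add l c

    unshift-succ : ∀ l l′ → l′ + c ≡ l + c + + 1 → l′ ≡ l + + 1
    unshift-succ l l′ e = begin
      l′                 ≡⟨ add-sub l′ c ⟨
      l′ + c - c         ≡⟨ cong (_- c) e ⟩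
      l + c + + 1 - c    ≡⟨ add-succ-sub l c ⟩
      l + + 1            ∎
      where open ≡-Reasoning

  relabelBy : (ℤ → Symmetry) → Vertex → Vertex
  relabelBy F v = level v , inn (F (level v)) (inLabel v) , out (F (level v + + 1)) (outLabel v)

  relabel-adj : ∀ (F : ℤ → Symmetry) {u v} → level v ≡ level u + + 1 →
                adj (out (F (level u + + 1)) (outLabel u)) (inn (F (level v)) (inLabel v)) ≡
                adj (outLabel u) (inLabel v)
  relabel-adj F {u} {v} e rewrite e = Symmetry.adj-invariant (F (level u + + 1)) (outLabel u) (inLabel v)

  -- The symmetry F l acts on the edges between the layers l − 1 and l.
  relabel : (ℤ → Symmetry) → Automorphism layered
  relabel F = mkAutomorphism (relabelBy F) (relabelBy (λ l → F l ⁻¹ˢ))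
    (λ v → cong₂ (λ t s → level v , t , s) (Inverse.inverseˡ (Symmetry.onIn (F (level v))) refl)
                                            (Inverse.inverseˡ (Symmetry.onOut (F (level v + + 1))) refl))
    (λ v → cong₂ (λ t s → level v , t , s) (Inverse.inverseʳ (Symmetry.onIn (F (level v))) refl)
                                            (Inverse.inverseʳ (Symmetry.onOut (F (level v + + 1))) refl))
    (λ u v → mk⇔ (λ (e , a) → e , subst T (sym (relabel-adj F {u} {v} e)) a)
                 (λ (e , a) → e , subst T (relabel-adj F {u} {v} e) a))

  _[_≔_] : (ℤ → Symmetry) → ℤ → Symmetry → ℤ → Symmetry
  (F [ a ≔ g ]) j with j ℤ.≟ a
  ... | yes _ = g
  ... | no  _ = F j

  ≔-same : ∀ F a g → (F [ a ≔ g ]) a ≡ g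
  ≔-same F a g with a ℤ.≟ a
  ... | yes _   = refl
  ... | no  a≢a = ⊥-elim (a≢a refl)

  ≔-other : ∀ F {a j} g → j ≢ a → (F [ a ≔ g ]) j ≡ F j
  ≔-other F {a} {j} g j≢a with j ℤ.≟ a
  ... | yes j≡a = ⊥-elim (j≢a j≡a)
  ... | no  _   = refl

  layerFamily : ℤ → Symmetry → Symmetry → ℤ → Symmetry
  layerFamily a g h = ((λ _ → idˢ) [ a ≔ g ]) [ a + + 1 ≔ h ]

  layerFamily-at : ∀ a g h → layerFamily a g h a ≡ g
  layerFamily-at a g h = trans (≔-other _ h (ℤ.<⇒≢ (i<i+1 a))) (≔-same _ a g)

  layerFamily-at-suc : ∀ a g h → layerFamily a g h (a + + 1) ≡ h
  layerFamily-at-suc a g h = ≔-same _ (a + + 1) h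

  layerFamily-below : ∀ {a j} g h → j < a → layerFamily a g h j ≡ idˢ
  layerFamily-below {a} g h j<a =
    trans (≔-other _ h (ℤ.<⇒≢ (ℤ.<-trans j<a (i<i+1 a)))) (≔-other _ g (ℤ.<⇒≢ j<a))

  relabelLayer : ℤ → Symmetry → Symmetry → Automorphism layered
  relabelLayer a g h = relabel (layerFamily a g h)

  relabelLayer-at : ∀ a g h t s → act (relabelLayer a g h) (a , t , s) ≡ (a , inn g t , out h s)
  relabelLayer-at a g h t s =
    cong₂ (λ g′ h′ → a , inn g′ t , out h′ s) (layerFamily-at a g h) (layerFamily-at-suc a g h)

  relabelLayer-before : ∀ l g h t s → act (relabelLayer (l + + 1) g h) (l , t , s) ≡ (l , t , out g s)
  relabelLayer-before l g h t s =
    cong₂ (λ g′ h′ → l , inn g′ t , out h′ s) (layerFamily-below g h (i<i+1 l)) (layerFamily-at (l + + 1) g h)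

  relabelLayer-fixes-below : ∀ {a l} g h t s → l + + 1 < a → act (relabelLayer a g h) (l , t , s) ≡ (l , t , s)
  relabelLayer-fixes-below {l = l} g h t s l+1<a =
    cong₂ (λ g′ h′ → l , inn g′ t , out h′ s)
          (layerFamily-below g h (ℤ.<-trans (i<i+1 l) l+1<a)) (layerFamily-below g h l+1<a)

  module Arcs = ArcTransitivity layered level proj₁

  vertexTransitive : OutTransitive → InTransitive → Arcs.VertexTransitive
  vertexTransitive outTr inTr u (l′ , t′ , s′) = relabelLayer l′ g h ∘ᵃ shift (l′ - level u) , (begin
    act (relabelLayer l′ g h) (level u + (l′ - level u) , inLabel u , outLabel u)
      ≡⟨ cong (λ k → act (relabelLayer l′ g h) (k , inLabel u , outLabel u)) (add-diff (level u) l′) ⟩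
    act (relabelLayer l′ g h) (l′ , inLabel u , outLabel u)
      ≡⟨ relabelLayer-at l′ g h (inLabel u) (outLabel u) ⟩
    (l′ , inn g (inLabel u) , out h (outLabel u))
      ≡⟨ cong₂ (λ t s → l′ , t , s) (proj₂ (inTr (inLabel u) t′)) (proj₂ (outTr (outLabel u) s′)) ⟩
    (l′ , t′ , s′) ∎)
    where
    open ≡-Reasoning
    g = proj₁ (inTr (inLabel u) t′)
    h = proj₁ (outTr (outLabel u) s′)
    add-diff : ∀ l l′ → l + (l′ - l) ≡ l′
    add-diff = solve-∀

  outNeighbourTransitive : OutTransitive → LocallyTransitive → Arcs.OutNeighbourTransitiveFixingBelow
  outNeighbourTransitive outTr locTr {v} {_ , tx , sx} {_ , ty , sy} (refl , vx) (refl , vy) =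
    relabelLayer (level v + + 1) ρ ν ,
    trans (relabelLayer-before (level v) ρ ν (inLabel v) (outLabel v))
          (cong (λ s → level v , inLabel v , s) (proj₁ (proj₂ (locTr vx vy)))) ,
    trans (relabelLayer-at (level v + + 1) ρ ν tx sx)
          (cong₂ (λ t s → level v + + 1 , t , s) (proj₂ (proj₂ (locTr vx vy))) (proj₂ (outTr sx sy))) ,
    λ (l , t , s) l<lv → relabelLayer-fixes-below ρ ν t s (ℤ.+-monoˡ-< (+ 1) l<lv)
    where
    ρ = proj₁ (locTr vx vy)
    ν = proj₁ (outTr sx sy)

  layered-HAT : OutTransitive → InTransitive → LocallyTransitive → ∀ {s₀ t₀} → Adj s₀ t₀ → HAT layered
  layered-HAT outTr inTr locTr s₀t₀ n =
    verticalArc s₀t₀ n ,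
    Arcs.arcTransitive (vertexTransitive outTr inTr) (outNeighbourTransitive outTr locTr)

  Δ-notCompleteBipartite : (∀ s → HasNonNeighbourAtDistance3 s) →
                           ∀ e → ¬ CompleteBipartiteΔ layered e
  Δ-notCompleteBipartite far e@((u , v) , v-level , _) cb with far (outLabel u)
  ... | s′ , t′ , t , st′ , s′t′ , s′t , ¬st =
    ¬st (proj₂ (completeBipartiteΔ-joins {layered} {e} {f} cb (proj₁ reach) (proj₂ reach)))
    where
    w  = level v , t′ , outLabel v
    u′ = level u , inLabel u , s′
    v′ = level v , t , outLabel v
    f : Edge layered
    f = (u′ , v′) , v-level , s′t
    reach = reachable-zigzag e ((u , w) , v-level , st′) ((u′ , w) , v-level , s′t′) f refl refl refl

data ℤ₃ : Set where
  0₃ 1₃ 2₃ : ℤ₃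

ℤ₃-finitelyEnumerable : FinitelyEnumerable ℤ₃
ℤ₃-finitelyEnumerable = 3 , enum , λ { 0₃ → zero , refl ; 1₃ → suc zero , refl ; 2₃ → suc (suc zero) , refl }
  where
  enum : Fin 3 → ℤ₃
  enum zero             = 0₃
  enum (suc zero)       = 1₃
  enum (suc (suc zero)) = 2₃

-- C₆ is K₃,₃ with the perfect matching s ↔ s − 1 removed.
adjacent₆ : ℤ₃ → ℤ₃ → Bool
adjacent₆ 0₃ 2₃ = false
adjacent₆ 1₃ 0₃ = false
adjacent₆ 2₃ 1₃ = false
adjacent₆ _  _  = true

hexagon : LabelGraph
hexagon = record { Out = ℤ₃ ; In = ℤ₃ ; adj = adjacent₆ }

open LabelGraph hexagon

suc₃ pred₃ : ℤ₃ → ℤ₃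
suc₃ 0₃ = 1₃
suc₃ 1₃ = 2₃
suc₃ 2₃ = 0₃
pred₃ 0₃ = 2₃
pred₃ 1₃ = 0₃
pred₃ 2₃ = 1₃

suc₃-pred₃ : ∀ x → suc₃ (pred₃ x) ≡ x
suc₃-pred₃ 0₃ = refl
suc₃-pred₃ 1₃ = refl
suc₃-pred₃ 2₃ = refl

pred₃-suc₃ : ∀ x → pred₃ (suc₃ x) ≡ x
pred₃-suc₃ 0₃ = refl
pred₃-suc₃ 1₃ = refl
pred₃-suc₃ 2₃ = refl

rotate-invariant : ∀ s t → adjacent₆ (suc₃ s) (suc₃ t) ≡ adjacent₆ s t
rotate-invariant 0₃ 0₃ = refl
rotate-invariant 0₃ 1₃ = refl
rotate-invariant 0₃ 2₃ = refl
rotate-invariant 1₃ 0₃ = refl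
rotate-invariant 1₃ 1₃ = refl
rotate-invariant 1₃ 2₃ = refl
rotate-invariant 2₃ 0₃ = refl
rotate-invariant 2₃ 1₃ = refl
rotate-invariant 2₃ 2₃ = refl

rotate : Symmetry
rotate = record
  { onOut         = mk↔ₛ′ suc₃ pred₃ suc₃-pred₃ pred₃-suc₃
  ; onIn          = mk↔ₛ′ suc₃ pred₃ suc₃-pred₃ pred₃-suc₃
  ; adj-invariant = rotate-invariant }

rotation : ℤ₃ → Symmetry
rotation 0₃ = idˢ
rotation 1₃ = rotate
rotation 2₃ = rotate ∘ˢ rotate

rotation-orbit : ∀ x → out (rotation x) 0₃ ≡ x × inn (rotation x) 0₃ ≡ x
rotation-orbit 0₃ = refl , refl
rotation-orbit 1₃ = refl , refl
rotation-orbit 2₃ = refl , refl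

neg₃ one-minus₃ : ℤ₃ → ℤ₃
neg₃ 0₃ = 0₃
neg₃ 1₃ = 2₃
neg₃ 2₃ = 1₃
one-minus₃ 0₃ = 1₃
one-minus₃ 1₃ = 0₃
one-minus₃ 2₃ = 2₃

neg₃-involutive : ∀ x → neg₃ (neg₃ x) ≡ x
neg₃-involutive 0₃ = refl
neg₃-involutive 1₃ = refl
neg₃-involutive 2₃ = refl

one-minus₃-involutive : ∀ x → one-minus₃ (one-minus₃ x) ≡ x
one-minus₃-involutive 0₃ = refl
one-minus₃-involutive 1₃ = refl
one-minus₃-involutive 2₃ = refl

reflect-invariant : ∀ s t → adjacent₆ (neg₃ s) (one-minus₃ t) ≡ adjacent₆ s t
reflect-invariant 0₃ 0₃ = refl
reflect-invariant 0₃ 1₃ = refl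
reflect-invariant 0₃ 2₃ = refl
reflect-invariant 1₃ 0₃ = refl
reflect-invariant 1₃ 1₃ = refl
reflect-invariant 1₃ 2₃ = refl
reflect-invariant 2₃ 0₃ = refl
reflect-invariant 2₃ 1₃ = refl
reflect-invariant 2₃ 2₃ = refl

reflect : Symmetry
reflect = record
  { onOut         = mk↔ₛ′ neg₃ neg₃ neg₃-involutive neg₃-involutive
  ; onIn          = mk↔ₛ′ one-minus₃ one-minus₃ one-minus₃-involutive one-minus₃-involutive
  ; adj-invariant = reflect-invariant }

stabiliser₀ : ∀ {t t′} → Adj 0₃ t → Adj 0₃ t′ → ∃[ g ] out g 0₃ ≡ 0₃ × inn g t ≡ t′
stabiliser₀ {0₃} {0₃} _ _ = idˢ , refl , refl
stabiliser₀ {0₃} {1₃} _ _ = reflect , refl , refl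
stabiliser₀ {1₃} {0₃} _ _ = reflect , refl , refl
stabiliser₀ {1₃} {1₃} _ _ = idˢ , refl , refl
stabiliser₀ {2₃} ()
stabiliser₀ {_} {2₃} _ ()

hexagon-outTransitive : OutTransitive
hexagon-outTransitive = outTransitive-fromOrbit 0₃ λ s → rotation s , proj₁ (rotation-orbit s)

hexagon-inTransitive : InTransitive
hexagon-inTransitive = inTransitive-fromOrbit 0₃ λ t → rotation t , proj₂ (rotation-orbit t)

hexagon-locallyTransitive : LocallyTransitive
hexagon-locallyTransitive =
  locallyTransitive-fromStabiliser 0₃ (λ s → rotation s , proj₁ (rotation-orbit s)) stabiliser₀

hexagon-outConnected : ∀ s → Star SharesNeighbour s 0₃
hexagon-outConnected 0₃ = ε
hexagon-outConnected 1₃ = (1₃ , tt , tt) ◅ ε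
hexagon-outConnected 2₃ = (0₃ , tt , tt) ◅ ε

hexagon-distance3 : ∀ s → HasNonNeighbourAtDistance3 s
hexagon-distance3 0₃ = 2₃ , 0₃ , 2₃ , tt , tt , tt , λ ()
hexagon-distance3 1₃ = 0₃ , 1₃ , 0₃ , tt , tt , tt , λ ()
hexagon-distance3 2₃ = 1₃ , 2₃ , 1₃ , tt , tt , tt , λ ()

open Layered hexagon

mainTheorem1 : Σ Digraph λ D →
    Connected D × HAT D ×
    (Σ (EpiToZ D) λ ψ → FiniteFibers ψ) ×
    (∀ e → ¬ CompleteBipartiteΔ D e)
mainTheorem1 =
  layered ,
  layered-connected {0₃} {0₃} tt hexagon-outConnected ,
  layered-HAT hexagon-outTransitive hexagon-inTransitive hexagon-locallyTransitive {0₃} {0₃} tt ,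
  (levelEpi 0₃ 0₃ ,
   levelEpi-finiteFibers 0₃ 0₃ (×-finitelyEnumerable ℤ₃-finitelyEnumerable ℤ₃-finitelyEnumerable)) ,
  Δ-notCompleteBipartite hexagon-distance3
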